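{- Let $m\geqslant 2$ and $k\geqslant 1$. Then for all $j\in\mathcal{A}_m\setminus\{0\}$, \[\binom{\sigma_m^k(0)}{0\,\overline{1}\cdots\overline{k}}-\binom{\sigma_m^k(j)}{0\,\overline{1}\cdots\overline{k}}=m^{\binom{k}{2}}.\] In particular, the coefficients $\binom{\sigma_m^k(j)}{0\,\overline{1}\cdots\overline{k}}$ are identical for all $j\neq 0$.
   Context: $\mathcal{A}_m=\{0,\ldots,m-1\}=\mathbb{Z}/m\mathbb{Z}$; all letters are reduced modulo $m$, and for $a\in\mathbb{N}$, $\overline{a}$ denotes the letter $-a \bmod m$, so $0\,\overline{1}\cdots\overline{k}$ is the word $0\,(m-1)\,(m-2)\cdots$ of length $k+1$ (indices mod $m$). $\sigma_m$ is the morphism $\sigma_m(i)=i\,(i+1)\cdots(i+m-1)$. For words $u,w$, $\binom{u}{w}$ is the number of occurrences of $w$ as a (not necessarily contiguous) subword of $u$. -}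

module Defs where

open import Data.Nat using (ℕ; zero; suc; _+_; _∸_; NonZero)
open import Data.Nat.DivMod using (_%_; _mod_)
open import Data.Fin using (Fin; toℕ)
open import Data.List using (List; []; _∷_; concatMap; upTo; map)
open import Data.Bool using (if_then_else_)
open import Relation.Nullary.Decidable using (⌊_⌋)
import Data.Fin as F

-- Alphabet A_m = Z/mZ, represented by Fin m; a letter a ∈ ℕ is reduced mod m.
letter : (m : ℕ) .{{_ : NonZero m}} → ℕ → Fin m
letter m a = a mod m

bar : (m : ℕ) .{{_ : NonZero m}} → ℕ → Fin m
bar m a = letter m (m ∸ (a % m))

σ : (m : ℕ) .{{_ : NonZero m}} → Fin m → List (Fin m)
σ m i = map (λ t → letter m (toℕ i + t)) (upTo m)

σw : (m : ℕ) .{{_ : NonZero m}} → List (Fin m) → List (Fin m)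
σw m = concatMap (σ m)

σw^ : (m : ℕ) .{{_ : NonZero m}} → ℕ → List (Fin m) → List (Fin m)
σw^ m zero    w = w
σw^ m (suc k) w = σw m (σw^ m k w)

binom : {m : ℕ} → List (Fin m) → List (Fin m) → ℕ
binom u        []       = 1
binom []       (_ ∷ _)  = 0
binom (a ∷ u)  (b ∷ w)  =
  (if ⌊ a F.≟ b ⌋ then binom u w else 0) + binom u (b ∷ w)

negWord : (m : ℕ) .{{_ : NonZero m}} → ℕ → List (Fin m)
negWord m k = map (bar m) (upTo (suc k))

{-# OPTIONS --safe #-}
module Submission where

-- Write φₙ(u, d) for the number of occurrences in u of the descending word d (d−1) ⋯ (d−n+1) and
-- Mᵣ = m ^ (r C 2).  By induction on r, for every letter x:
--   (i)  φₙ(σʳ(x), d) does not depend on d when n ≤ r;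
--   (ii) φᵣ₊₁(σʳ(x), d) − Mᵣ·[x = d] does not depend on d.
-- By the concatenation formula φₙ(uv, d) is a convolution of the φᵢ(u, ·) and φⱼ(v, ·), so both
-- properties pass from letters to words.  For the step, σ(x) = x·R and σ(x+1) = R·x, hence
-- σʳ⁺¹(x) = σʳ(x)·σʳ(R), while σʳ⁺¹(x+1) = σʳ(R)·σʳ(x) is its image under the shift, which moves d
-- to d+1.  The two convolutions agree term by term except for the term taking a single letter from
-- the first factor.  This gives (i) at level r+1, and shows that φᵣ₊₂(σʳ⁺¹(x), ·) increases from
-- d−1 to d by (|σʳ(x)|_d + |σʳ(R)|_d)·Mᵣ·([x = d] − [x = d−1]) = mʳ·Mᵣ·(…) = Mᵣ₊₁·(…), which is (ii)
-- at level r+1.  The theorem is (ii) for r = k compared at d = j and d = 0, together with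
-- φ(σᵏ(0), 0) = φ(σᵏ(j), j).

open import Defs
open import Data.Nat using (ℕ; _≤_; _^_; NonZero)
open import Data.Nat.Combinatorics using (_C_)
open import Data.Fin using (Fin)
open import Data.List using ([_])
open import Data.Integer using (ℤ; +_; _-_)
open import Relation.Binary.PropositionalEquality using (_≡_; _≢_)

open import Data.Bool using (true; false)
open import Data.Fin as Fin using (toℕ; zero; suc; inject₁; fromℕ; opposite)
open import Data.Fin.Permutation using (reverse)
open import Data.Fin.Properties
  using (toℕ-injective; toℕ-fromℕ<; toℕ-inject₁; toℕ-fromℕ; toℕ≤pred[n]; toℕ<n; opposite-prop)
open import Data.Integer as ℤ using ()
import Data.Integer.Properties as ℤₚ
import Data.Integer.Tactic.RingSolver as ℤ-Ring
open import Data.List using (List; []; _∷_; _++_; _∷ʳ_; map; length; take; drop; iterate; upTo; applyUpTo)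
open import Data.List.Properties
  using (length-iterate; map-++; map-cong; map-∘; map-upTo; map-applyUpTo; upTo-∷ʳ; map-concatMap; concatMap-map;
         concatMap-cong; concatMap-++; ++-identityʳ; length-++; length-map; length-upTo)
open import Data.Nat using (zero; suc; _+_; _*_; _∸_; _<_; z≤n; s≤s; z<s; s<s)
open import Data.Nat.Combinatorics using (nC1≡n; nCk+nC[k+1]≡[n+1]C[k+1])
open import Data.Nat.DivMod
  using (_%_; _/_; m%n<n; m%n≤n; m≡m%n+[m/n]*n; m<n⇒m%n≡m; n%n≡0; %-distribˡ-+; m%n%n≡m%n; [m+n]%n≡m%n; [m+kn]%n≡m%n)
open import Data.Nat.Properties
open import Data.Nat.Tactic.RingSolver using (solve-∀)
open import Algebra.Properties.CommutativeMonoid.Sum +-0-commutativeMonoid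
  using (sum⁺-syntax; sum-syntax; ∑-permute; ∑-distrib-+; sum-cong-≗; sum-init-last; sum-replicate-zero)
open import Algebra.Properties.CommutativeSemigroup +-commutativeSemigroup using (x∙yz≈y∙xz)
open import Function using (_∘_)
open import Function.Definitions using (Injective)
open import Relation.Binary.PropositionalEquality using (refl; sym; trans; cong; cong₂; subst; module ≡-Reasoning)
open import Relation.Nullary.Decidable using (⌊_⌋; yes; no)
open import Relation.Nullary.Negation using (contradiction)

module _ {m : ℕ} where

  count : List (Fin m) → Fin m → ℕ
  count u a = binom u [ a ]

  binom-++ : ∀ (u v w : List (Fin m)) →
             binom (u ++ v) w ≡ ∑[ i ≤ length w ] (binom u (take (toℕ i) w) * binom v (drop (toℕ i) w))
  binom-++ []      v []      = refl
  binom-++ []      v (b ∷ w) = sym (trans (cong (λ s → 1 * binom v (b ∷ w) + s) (sum-replicate-zero (suc (length w))))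
                                         (trans (+-identityʳ _) (*-identityˡ _)))
  binom-++ (a ∷ u) v []      = refl
  binom-++ (a ∷ u) v (b ∷ w) with ⌊ a Fin.≟ b ⌋
  ... | false = binom-++ u v (b ∷ w)
  ... | true  = begin
    binom (u ++ v) w + binom (u ++ v) (b ∷ w)    ≡⟨ cong₂ _+_ (binom-++ u v w) (binom-++ u v (b ∷ w)) ⟩
    ∑[ i ≤ n ] X i + (V + ∑[ i ≤ n ] Y i)        ≡⟨ x∙yz≈y∙xz (∑[ i ≤ n ] X i) V (∑[ i ≤ n ] Y i) ⟩
    V + (∑[ i ≤ n ] X i + ∑[ i ≤ n ] Y i)        ≡⟨ cong (λ s → V + s) (∑-distrib-+ X Y) ⟨
    V + ∑[ i ≤ n ] (X i + Y i)                   ≡⟨ cong (λ s → V + s) (sum-cong-≗ distrib) ⟨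
    V + ∑[ i ≤ n ] ((binom u (take (toℕ i) w) + binom u (b ∷ take (toℕ i) w)) * binom v (drop (toℕ i) w)) ∎
    where
    open ≡-Reasoning
    n = length w
    V = 1 * binom v (b ∷ w)
    X Y : Fin (suc n) → ℕ
    X i = binom u (take (toℕ i) w) * binom v (drop (toℕ i) w)
    Y i = binom u (b ∷ take (toℕ i) w) * binom v (drop (toℕ i) w)
    distrib : ∀ i → (binom u (take (toℕ i) w) + binom u (b ∷ take (toℕ i) w)) * binom v (drop (toℕ i) w) ≡ X i + Y i
    distrib i = *-distribʳ-+ (binom v (drop (toℕ i) w)) (binom u (take (toℕ i) w)) (binom u (b ∷ take (toℕ i) w))

  count-applyUpTo-≢ : ∀ n (f : ℕ → Fin m) e → (∀ t → t < n → f t ≢ e) → count (applyUpTo f n) e ≡ 0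
  count-applyUpTo-≢ zero    f e f≢e = refl
  count-applyUpTo-≢ (suc n) f e f≢e with f 0 Fin.≟ e
  ... | yes f0≡e = contradiction f0≡e (f≢e 0 z<s)
  ... | no  _    = count-applyUpTo-≢ n (f ∘ suc) e (λ t t<n → f≢e (suc t) (s<s t<n))

  count-self : ∀ (x : Fin m) → count [ x ] x ≡ 1
  count-self x with x Fin.≟ x
  ... | yes _   = refl
  ... | no  x≢x = contradiction refl x≢x

  count-other : ∀ {x y : Fin m} → x ≢ y → count [ x ] y ≡ 0
  count-other {x} {y} x≢y with x Fin.≟ y
  ... | yes x≡y = contradiction x≡y x≢y
  ... | no  _   = refl

  count-++ : ∀ (u v : List (Fin m)) a → count (u ++ v) a ≡ count u a + count v a
  count-++ u v a = trans (binom-++ u v [ a ]) (arith (count u a) (count v a))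
    where
    arith : ∀ x y → y + 0 + (x * 1 + 0) ≡ x + y
    arith = solve-∀

module _ {m n : ℕ} {f : Fin m → Fin n} (f-injective : Injective _≡_ _≡_ f) where

  ⌊≟⌋-injective : ∀ a b → ⌊ f a Fin.≟ f b ⌋ ≡ ⌊ a Fin.≟ b ⌋
  ⌊≟⌋-injective a b with a Fin.≟ b | f a Fin.≟ f b
  ... | yes _   | yes _     = refl
  ... | no  _   | no  _     = refl
  ... | yes a≡b | no fa≢fb  = contradiction (cong f a≡b) fa≢fb
  ... | no  a≢b | yes fa≡fb = contradiction (f-injective fa≡fb) a≢b

  binom-map : ∀ u w → binom (map f u) (map f w) ≡ binom u w
  binom-map u       []      = refl
  binom-map []      (b ∷ w) = refl
  binom-map (a ∷ u) (b ∷ w) rewrite ⌊≟⌋-injective a b | binom-map u w | binom-map u (b ∷ w) = refl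

take-iterate : ∀ {a} {A : Set a} (f : A → A) x {i n} → i ≤ n → take i (iterate f x n) ≡ iterate f x i
take-iterate f x {zero}          _         = refl
take-iterate f x {suc i} {suc n} (s≤s i≤n) = cong (x ∷_) (take-iterate f (f x) i≤n)

∑-convolution-comm : ∀ n (a b : ℕ → ℕ) →
  ∑[ i ≤ n ] (a (toℕ i) * b (n ∸ toℕ i)) ≡ ∑[ i ≤ n ] (b (toℕ i) * a (n ∸ toℕ i))
∑-convolution-comm n a b = trans (∑-permute (λ i → a (toℕ i) * b (n ∸ toℕ i)) reverse) (sum-cong-≗ reflect)
  where
  reflect : ∀ (i : Fin (suc n)) → a (toℕ (opposite i)) * b (n ∸ toℕ (opposite i)) ≡ b (toℕ i) * a (n ∸ toℕ i)
  reflect i rewrite opposite-prop i | m∸[m∸n]≡n (toℕ≤pred[n] i) = *-comm (a (n ∸ toℕ i)) (b (toℕ i))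

∑-ends : ∀ r (f : ℕ → ℕ) → ∑[ i ≤ suc r ] f (toℕ i) ≡ f 0 + ∑[ i < r ] f (suc (toℕ i)) + f (suc r)
∑-ends r f = begin
  f 0 + ∑[ i ≤ r ] f (suc (toℕ i))
    ≡⟨ cong (λ s → f 0 + s) (sum-init-last (λ i → f (suc (toℕ i)))) ⟩
  f 0 + (∑[ i < r ] f (suc (toℕ (inject₁ i))) + f (suc (toℕ (fromℕ r))))
    ≡⟨ cong₂ (λ s t → f 0 + (s + f (suc t))) (sum-cong-≗ {r} (cong (f ∘ suc) ∘ toℕ-inject₁)) (toℕ-fromℕ r) ⟩
  f 0 + (∑[ i < r ] f (suc (toℕ i)) + f (suc r))
    ≡⟨ +-assoc (f 0) _ _ ⟨
  f 0 + ∑[ i < r ] f (suc (toℕ i)) + f (suc r)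
    ∎
  where open ≡-Reasoning

[m%d+n]%d≡[m+n]%d : ∀ m n d .{{_ : NonZero d}} → (m % d + n) % d ≡ (m + n) % d
[m%d+n]%d≡[m+n]%d m n d = begin
  (m % d + n) % d          ≡⟨ %-distribˡ-+ (m % d) n d ⟩
  (m % d % d + n % d) % d  ≡⟨ cong (λ k → (k + n % d) % d) (m%n%n≡m%n m d) ⟩
  (m % d + n % d) % d      ≡⟨ %-distribˡ-+ m n d ⟨
  (m + n) % d              ∎
  where open ≡-Reasoning

pos-isolate-+-* : ∀ {a b c x y} → a + b * x ≡ c + b * y → + a ≡ + c ℤ.+ + b ℤ.* (+ y - + x)
pos-isolate-+-* {a} {b} {c} {x} {y} eq = begin
  + a                                  ≡⟨ isolate (+ a) (+ b) (+ x) ⟩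
  (+ a ℤ.+ + b ℤ.* + x) - + b ℤ.* + x  ≡⟨ cong (λ t → t - + b ℤ.* + x) lifted ⟩
  (+ c ℤ.+ + b ℤ.* + y) - + b ℤ.* + x  ≡⟨ regroup (+ c) (+ b) (+ x) (+ y) ⟩
  + c ℤ.+ + b ℤ.* (+ y - + x)          ∎
  where
  open ≡-Reasoning
  lifted : + a ℤ.+ + b ℤ.* + x ≡ + c ℤ.+ + b ℤ.* + y
  lifted = trans (sym (pos-+-* a b x)) (trans (cong +_ eq) (pos-+-* c b y))
    where
    pos-+-* : ∀ a b x → + (a + b * x) ≡ + a ℤ.+ + b ℤ.* + x
    pos-+-* a b x = trans (ℤₚ.pos-+ a (b * x)) (cong (λ t → + a ℤ.+ t) (ℤₚ.pos-* b x))
  isolate : ∀ a b x → a ≡ (a ℤ.+ b ℤ.* x) - b ℤ.* x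
  isolate = ℤ-Ring.solve-∀
  regroup : ∀ c b x y → (c ℤ.+ b ℤ.* y) - b ℤ.* x ≡ c ℤ.+ b ℤ.* (y - x)
  regroup = ℤ-Ring.solve-∀

pos-isolate-+ : ∀ {a b c} → a + b ≡ c → + b ≡ + c - + a
pos-isolate-+ {a} {b} {c} eq = begin
  + b                  ≡⟨ isolate (+ a) (+ b) ⟩
  (+ a ℤ.+ + b) - + a  ≡⟨ cong (λ t → t - + a) (trans (sym (ℤₚ.pos-+ a b)) (cong +_ eq)) ⟩
  + c - + a            ∎
  where
  open ≡-Reasoning
  isolate : ∀ a b → b ≡ (a ℤ.+ b) - a
  isolate = ℤ-Ring.solve-∀

pos-difference-+ : ∀ a b c a′ b′ → + (a + b + c) - + (a′ + b′ + c) ≡ (+ a - + a′) ℤ.+ (+ b - + b′)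
pos-difference-+ a b c a′ b′ = begin
  + (a + b + c) - + (a′ + b′ + c)                      ≡⟨ cong₂ _-_ (lift a b c) (lift a′ b′ c) ⟩
  (+ a ℤ.+ + b ℤ.+ + c) - (+ a′ ℤ.+ + b′ ℤ.+ + c)      ≡⟨ regroup (+ a) (+ b) (+ c) (+ a′) (+ b′) ⟩
  (+ a - + a′) ℤ.+ (+ b - + b′)                        ∎
  where
  open ≡-Reasoning
  lift : ∀ a b c → + (a + b + c) ≡ + a ℤ.+ + b ℤ.+ + c
  lift a b c = trans (ℤₚ.pos-+ (a + b) c) (cong (λ t → t ℤ.+ + c) (ℤₚ.pos-+ a b))
  regroup : ∀ a b c a′ b′ → (a ℤ.+ b ℤ.+ c) - (a′ ℤ.+ b′ ℤ.+ c) ≡ (a - a′) ℤ.+ (b - b′)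
  regroup = ℤ-Ring.solve-∀

^-C2-suc : ∀ m r → m ^ (suc r C 2) ≡ m ^ r * m ^ (r C 2)
^-C2-suc m r = begin
  m ^ (suc r C 2)       ≡⟨ cong (m ^_) (nCk+nC[k+1]≡[n+1]C[k+1] r 1) ⟨
  m ^ (r C 1 + r C 2)   ≡⟨ cong (λ k → m ^ (k + r C 2)) (nC1≡n r) ⟩
  m ^ (r + r C 2)       ≡⟨ ^-distribˡ-+-* m r (r C 2) ⟩
  m ^ r * m ^ (r C 2)   ∎
  where open ≡-Reasoning

module _ {m′ : ℕ} where

  private
    m : ℕ
    m = suc m′

  toℕ-letter : ∀ a → toℕ (letter m a) ≡ a % m
  toℕ-letter a = toℕ-fromℕ< (m%n<n a m)

  letter-% : ∀ a b → a % m ≡ b % m → letter m a ≡ letter m b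
  letter-% a b eq = toℕ-injective (trans (toℕ-letter a) (trans eq (sym (toℕ-letter b))))

  letter-toℕ : ∀ (x : Fin m) → letter m (toℕ x) ≡ x
  letter-toℕ x = toℕ-injective (trans (toℕ-letter (toℕ x)) (m<n⇒m%n≡m (toℕ<n x)))

  shift : ℕ → Fin m → Fin m
  shift c x = letter m (toℕ x + c)

  letter-%-+ : ∀ a b → letter m (a % m + b) ≡ letter m (a + b)
  letter-%-+ a b = letter-% (a % m + b) (a + b) ([m%d+n]%d≡[m+n]%d a b m)

  shift-shift : ∀ a b x → shift a (shift b x) ≡ shift (b + a) x
  shift-shift a b x = begin
    letter m (toℕ (shift b x) + a)   ≡⟨ cong (λ k → letter m (k + a)) (toℕ-letter (toℕ x + b)) ⟩
    letter m ((toℕ x + b) % m + a)   ≡⟨ letter-%-+ (toℕ x + b) a ⟩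
    letter m (toℕ x + b + a)         ≡⟨ cong (letter m) (+-assoc (toℕ x) b a) ⟩
    letter m (toℕ x + (b + a))       ∎
    where open ≡-Reasoning

  shift-zero : ∀ x → shift 0 x ≡ x
  shift-zero x = trans (cong (letter m) (+-identityʳ (toℕ x))) (letter-toℕ x)

  shift-period : ∀ x → shift m x ≡ x
  shift-period x = trans (letter-% (toℕ x + m) (toℕ x) ([m+n]%n≡m%n (toℕ x) m)) (letter-toℕ x)

  shift-comm : ∀ a b x → shift a (shift b x) ≡ shift b (shift a x)
  shift-comm a b x = trans (shift-shift a b x) (trans (cong (λ c → shift c x) (+-comm b a)) (sym (shift-shift b a x)))

  shift-injective : ∀ c → Injective _≡_ _≡_ (shift c)
  shift-injective c {x} {y} eq = begin
    x                          ≡⟨ undo x ⟨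
    shift (m′ * c) (shift c x) ≡⟨ cong (shift (m′ * c)) eq ⟩
    shift (m′ * c) (shift c y) ≡⟨ undo y ⟩
    y                          ∎
    where
    open ≡-Reasoning
    undo : ∀ z → shift (m′ * c) (shift c z) ≡ z
    undo z = trans (shift-shift (m′ * c) c z)
                   (trans (letter-% (toℕ z + m * c) (toℕ z) period) (letter-toℕ z))
      where
      period : (toℕ z + m * c) % m ≡ toℕ z % m
      period = trans (cong (λ k → (toℕ z + k) % m) (*-comm m c)) ([m+kn]%n≡m%n (toℕ z) c m)

  prev : Fin m → Fin m
  prev = shift m′

  prev-shift-suc : ∀ k x → prev (shift (suc k) x) ≡ shift k x
  prev-shift-suc k x = begin
    shift m′ (shift (suc k) x) ≡⟨ shift-shift m′ (suc k) x ⟩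
    shift (suc k + m′) x       ≡⟨ cong (λ c → shift c x) (cong suc (+-comm m′ k)) ⟨
    shift (m + k) x            ≡⟨ shift-shift k m x ⟨
    shift k (shift m x)        ≡⟨ cong (shift k) (shift-period x) ⟩
    shift k x                  ∎
    where open ≡-Reasoning

  prev-shift : ∀ x → prev (shift 1 x) ≡ x
  prev-shift x = trans (prev-shift-suc 0 x) (shift-zero x)

  shift-prev : ∀ x → shift 1 (prev x) ≡ x
  shift-prev x = trans (shift-comm 1 m′ x) (prev-shift x)

  Constant : ∀ {a} {A : Set a} → (Fin m → A) → Set a
  Constant f = ∀ x y → f x ≡ f y

  prev-invariant⇒constant : ∀ {a} {A : Set a} (f : Fin m → A) → (∀ x → f (prev x) ≡ f x) → Constant f
  prev-invariant⇒constant f inv x y = trans (orbit x) (sym (orbit y))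
    where
    z = letter m 0
    f-shift : ∀ k → f (shift k z) ≡ f z
    f-shift zero    = cong f (shift-zero z)
    f-shift (suc k) = trans (sym (inv (shift (suc k) z))) (trans (cong f (prev-shift-suc k z)) (f-shift k))
    orbit : ∀ x → f x ≡ f z
    orbit x = trans (cong f (sym (letter-toℕ x))) (f-shift (toℕ x))

  differences-from-prev : ∀ (f g : Fin m → ℤ) c → (∀ x → f x - f (prev x) ≡ c ℤ.* (g x - g (prev x))) →
                          ∀ x y → f y - f x ≡ c ℤ.* (g y - g x)
  differences-from-prev f g c step x y = begin
    f y - f x                                          ≡⟨ split (f y) (f x) c (g y) (g x) ⟩
    (F y - F x) ℤ.+ c ℤ.* (g y - g x)                  ≡⟨ cong (λ t → (t - F x) ℤ.+ c ℤ.* (g y - g x)) (F-constant y x) ⟩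
    (F x - F x) ℤ.+ c ℤ.* (g y - g x)                  ≡⟨ cancel (F x) (c ℤ.* (g y - g x)) ⟩
    c ℤ.* (g y - g x)                                  ∎
    where
    open ≡-Reasoning
    F : Fin m → ℤ
    F z = f z - c ℤ.* g z
    split : ∀ fy fx c gy gx → fy - fx ≡ ((fy - c ℤ.* gy) - (fx - c ℤ.* gx)) ℤ.+ c ℤ.* (gy - gx)
    split = ℤ-Ring.solve-∀
    cancel : ∀ a b → (a - a) ℤ.+ b ≡ b
    cancel = ℤ-Ring.solve-∀
    unfold : ∀ fz fp c gz gp → fp - c ℤ.* gp ≡ (fz - c ℤ.* gz) - ((fz - fp) - c ℤ.* (gz - gp))
    unfold = ℤ-Ring.solve-∀
    F-prev : ∀ z → F (prev z) ≡ F z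
    F-prev z = begin
      F (prev z)                        ≡⟨ unfold (f z) (f (prev z)) c (g z) (g (prev z)) ⟩
      F z - (Δf - c ℤ.* Δg)             ≡⟨ cong (λ t → F z - (t - c ℤ.* Δg)) (step z) ⟩
      F z - (c ℤ.* Δg - c ℤ.* Δg)       ≡⟨ cong (λ t → F z - t) (ℤₚ.+-inverseʳ (c ℤ.* Δg)) ⟩
      F z - + 0                         ≡⟨ ℤₚ.+-identityʳ (F z) ⟩
      F z                               ∎
      where
      Δf = f z - f (prev z)
      Δg = g z - g (prev z)
    F-constant : Constant F
    F-constant = prev-invariant⇒constant F F-prev

  desc : Fin m → ℕ → List (Fin m)
  desc = iterate prev

  map-shift-desc : ∀ c d n → map (shift c) (desc d n) ≡ desc (shift c d) n
  map-shift-desc c d zero    = refl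
  map-shift-desc c d (suc n) =
    cong (shift c d ∷_) (trans (map-shift-desc c (prev d) n) (cong (λ e → desc e n) (shift-comm c m′ d)))

  σ-shift : ∀ c x → map (shift c) (σ m x) ≡ σ m (shift c x)
  σ-shift c x = trans (sym (map-∘ (upTo m))) (map-cong (λ t → shift-comm c t x) (upTo m))

  σw-shift : ∀ c w → map (shift c) (σw m w) ≡ σw m (map (shift c) w)
  σw-shift c w = trans (map-concatMap (shift c) (σ m) w)
                       (trans (concatMap-cong (σ-shift c) w) (sym (concatMap-map (σ m) (shift c) w)))

  σw^-shift : ∀ c r w → map (shift c) (σw^ m r w) ≡ σw^ m r (map (shift c) w)
  σw^-shift c zero    w = refl
  σw^-shift c (suc r) w = trans (σw-shift c (σw^ m r w)) (cong (σw m) (σw^-shift c r w))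

  binom-σw^-shift : ∀ c r w d n → binom (σw^ m r (map (shift c) w)) (desc (shift c d) n) ≡ binom (σw^ m r w) (desc d n)
  binom-σw^-shift c r w d n = trans (cong₂ binom (sym (σw^-shift c r w)) (sym (map-shift-desc c d n)))
                                    (binom-map (shift-injective c) (σw^ m r w) (desc d n))

  σw^-++ : ∀ r (u v : List (Fin m)) → σw^ m r (u ++ v) ≡ σw^ m r u ++ σw^ m r v
  σw^-++ zero    u v = refl
  σw^-++ (suc r) u v = trans (cong (σw m) (σw^-++ r u v)) (concatMap-++ (σ m) (σw^ m r u) (σw^ m r v))

  σw^-suc-letter : ∀ r x → σw^ m (suc r) [ x ] ≡ σw^ m r (σ m x)
  σw^-suc-letter zero    x = ++-identityʳ (σ m x)
  σw^-suc-letter (suc r) x = cong (σw m) (σw^-suc-letter r x)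

  rest : Fin m → List (Fin m)
  rest x = map (λ t → shift (suc t) x) (upTo m′)

  σ-∷ : ∀ x → σ m x ≡ x ∷ rest x
  σ-∷ x = cong₂ _∷_ (shift-zero x)
                    (trans (map-applyUpTo suc (λ t → shift t x) m′) (sym (map-upTo (λ t → shift (suc t) x) m′)))

  σ-shift-1 : ∀ x → σ m (shift 1 x) ≡ rest x ++ [ x ]
  σ-shift-1 x = begin
    map g (upTo m)              ≡⟨ cong (map g) (upTo-∷ʳ m′) ⟨
    map g (upTo m′ ∷ʳ m′)       ≡⟨ map-++ g (upTo m′) [ m′ ] ⟩
    map g (upTo m′) ++ [ g m′ ] ≡⟨ cong₂ (λ u y → u ++ [ y ]) (map-cong (λ t → shift-shift t 1 x) (upTo m′))
                                                            (trans (shift-shift m′ 1 x) (shift-period x)) ⟩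
    rest x ++ [ x ]             ∎
    where
    open ≡-Reasoning
    g : ℕ → Fin m
    g t = shift t (shift 1 x)

  σw^-suc-split : ∀ r x → σw^ m (suc r) [ x ] ≡ σw^ m r [ x ] ++ σw^ m r (rest x)
  σw^-suc-split r x = trans (σw^-suc-letter r x) (trans (cong (σw^ m r) (σ-∷ x)) (σw^-++ r [ x ] (rest x)))

  σw^-suc-split-shift : ∀ r x → σw^ m (suc r) [ shift 1 x ] ≡ σw^ m r (rest x) ++ σw^ m r [ x ]
  σw^-suc-split-shift r x =
    trans (σw^-suc-letter r (shift 1 x)) (trans (cong (σw^ m r) (σ-shift-1 x)) (σw^-++ r (rest x) [ x ]))

  binom-σw^-prev : ∀ r x d n → binom (σw^ m r [ x ]) (desc (prev d) n) ≡ binom (σw^ m r [ shift 1 x ]) (desc d n)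
  binom-σw^-prev r x d n = sym (trans (cong (λ e → binom (σw^ m r [ shift 1 x ]) (desc e n)) (sym (shift-prev d)))
                                      (binom-σw^-shift 1 r [ x ] (prev d) n))

  count-rotate : ∀ x e → count (σ m (shift 1 x)) e ≡ count (σ m x) e
  count-rotate x e = begin
    count (σ m (shift 1 x)) e        ≡⟨ cong (λ u → count u e) (σ-shift-1 x) ⟩
    count (rest x ++ [ x ]) e        ≡⟨ count-++ (rest x) [ x ] e ⟩
    count (rest x) e + count [ x ] e ≡⟨ +-comm (count (rest x) e) (count [ x ] e) ⟩
    count [ x ] e + count (rest x) e ≡⟨ count-++ [ x ] (rest x) e ⟨
    count (x ∷ rest x) e             ≡⟨ cong (λ u → count u e) (σ-∷ x) ⟨
    count (σ m x) e                  ∎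
    where open ≡-Reasoning

  count-rest-self : count (rest (letter m 0)) (letter m 0) ≡ 0
  count-rest-self = trans (cong (λ u → count u (letter m 0)) (map-upTo (λ t → letter m (suc t)) m′))
                          (count-applyUpTo-≢ m′ (λ t → letter m (suc t)) (letter m 0) nonzero)
    where
    nonzero : ∀ t → t < m′ → letter m (suc t) ≢ letter m 0
    nonzero t t<m′ eq = 1+n≢0 (trans (sym (m<n⇒m%n≡m (s≤s t<m′))) (trans (sym (toℕ-letter (suc t))) (cong toℕ eq)))

  count-σ : ∀ x e → count (σ m x) e ≡ 1
  count-σ x e = begin
    count (σ m x) e                                       ≡⟨ prev-invariant⇒constant (λ y → count (σ m y) e) prev-invariant x e ⟩
    count (σ m e) e                                       ≡⟨ cong (λ y → count (σ m y) y) (letter-toℕ e) ⟨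
    -- shift c z computes to letter m c
    binom (σ m (shift c z)) (map (shift c) [ z ])         ≡⟨ cong (λ u → binom u [ shift c z ]) (σ-shift c z) ⟨
    binom (map (shift c) (σ m z)) (map (shift c) [ z ])   ≡⟨ binom-map (shift-injective c) (σ m z) [ z ] ⟩
    count (σ m z) z                                       ≡⟨ cong (λ u → count u z) (σ-∷ z) ⟩
    1 + count (rest z) z                                  ≡⟨ cong suc count-rest-self ⟩
    1                                                     ∎
    where
    open ≡-Reasoning
    z = letter m 0
    c = toℕ e
    prev-invariant : ∀ y → count (σ m (prev y)) e ≡ count (σ m y) e
    prev-invariant y = trans (sym (count-rotate (prev y) e)) (cong (λ y′ → count (σ m y′) e) (shift-prev y))

  count-σw : ∀ w e → count (σw m w) e ≡ length w
  count-σw []      e = refl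
  count-σw (x ∷ w) e = trans (count-++ (σ m x) (σw m w) e) (cong₂ _+_ (count-σ x e) (count-σw w e))

  length-σw : ∀ w → length (σw m w) ≡ m * length w
  length-σw []      = sym (*-zeroʳ m)
  length-σw (x ∷ w) = begin
    length (σ m x ++ σw m w)          ≡⟨ length-++ (σ m x) ⟩
    length (σ m x) + length (σw m w)  ≡⟨ cong₂ _+_ (trans (length-map _ (upTo m)) (length-upTo m)) (length-σw w) ⟩
    m + m * length w                  ≡⟨ *-suc m (length w) ⟨
    m * suc (length w)                ∎
    where open ≡-Reasoning

  length-σw^ : ∀ r w → length (σw^ m r w) ≡ m ^ r * length w
  length-σw^ zero    w = sym (+-identityʳ (length w))
  length-σw^ (suc r) w = trans (length-σw (σw^ m r w))
                               (trans (cong (m *_) (length-σw^ r w)) (sym (*-assoc m (m ^ r) (length w))))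

  count-σw^-suc : ∀ r x e → count (σw^ m (suc r) [ x ]) e ≡ m ^ r
  count-σw^-suc r x e = trans (count-σw (σw^ m r [ x ]) e) (trans (length-σw^ r [ x ]) (*-identityʳ (m ^ r)))

  shift-bar : ∀ a → shift a (bar m a) ≡ letter m 0
  shift-bar a = begin
    letter m (toℕ (bar m a) + a)                    ≡⟨ cong (λ k → letter m (k + a)) (toℕ-letter (m ∸ a % m)) ⟩
    letter m ((m ∸ a % m) % m + a)                  ≡⟨ letter-%-+ (m ∸ a % m) a ⟩
    letter m (m ∸ a % m + a)                        ≡⟨ cong (λ k → letter m (m ∸ a % m + k)) (m≡m%n+[m/n]*n a m) ⟩
    letter m (m ∸ a % m + (a % m + a / m * m))      ≡⟨ cong (letter m) (+-assoc (m ∸ a % m) (a % m) (a / m * m)) ⟨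
    letter m (m ∸ a % m + a % m + a / m * m)        ≡⟨ cong (λ k → letter m (k + a / m * m)) (m∸n+n≡m (m%n≤n a m)) ⟩
    letter m (m + a / m * m)                        ≡⟨ letter-% (m + a / m * m) m ([m+kn]%n≡m%n m (a / m) m) ⟩
    letter m m                                      ≡⟨ letter-% m 0 (n%n≡0 m) ⟩
    letter m 0                                      ∎
    where open ≡-Reasoning

  bar-suc : ∀ a → bar m (suc a) ≡ prev (bar m a)
  bar-suc a = shift-injective (suc a) (begin
    shift (suc a) (bar m (suc a))  ≡⟨ shift-bar (suc a) ⟩
    letter m 0                     ≡⟨ shift-bar a ⟨
    shift a (bar m a)              ≡⟨ prev-shift-suc a (bar m a) ⟨
    prev (shift (suc a) (bar m a)) ≡⟨ shift-comm (suc a) m′ (bar m a) ⟨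
    shift (suc a) (prev (bar m a)) ∎)
    where open ≡-Reasoning

  applyUpTo-desc : ∀ (f : ℕ → Fin m) → (∀ a → f (suc a) ≡ prev (f a)) → ∀ n → applyUpTo f n ≡ desc (f 0) n
  applyUpTo-desc f step zero    = refl
  applyUpTo-desc f step (suc n) =
    cong (f 0 ∷_) (trans (applyUpTo-desc (f ∘ suc) (step ∘ suc) n) (cong (λ d → desc d n) (step 0)))

  negWord-desc : ∀ k → negWord m k ≡ desc (letter m 0) (suc k)
  negWord-desc k = trans (map-upTo (bar m) (suc k))
    (trans (applyUpTo-desc (bar m) bar-suc (suc k)) (cong (λ d → desc d (suc k)) (letter-% m 0 (n%n≡0 m))))

  Uniform : ℕ → List (Fin m) → Set
  Uniform r u = ∀ {n} → n ≤ r → Constant (λ d → binom u (desc d n))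

  uniform-zero : ∀ u → Uniform 0 u
  uniform-zero u z≤n d e = refl

  conv : List (Fin m) → List (Fin m) → ℕ → Fin m → ℕ
  conv u v n d = ∑[ i ≤ n ] (binom u (desc d (toℕ i)) * binom v (desc d (n ∸ toℕ i)))

  conv-comm : ∀ u v n d → conv u v n d ≡ conv v u n d
  conv-comm u v n d = ∑-convolution-comm n (λ i → binom u (desc d i)) (λ i → binom v (desc d i))

  conv-constant : ∀ {r u v n} → Uniform r u → Uniform r v → n ≤ r → Constant (conv u v n)
  conv-constant {n = n} uu uv n≤r d e = sum-cong-≗ {suc n} (λ i →
    cong₂ _*_ (uu (≤-trans (toℕ≤pred[n] i) n≤r) d e) (uv (≤-trans (m∸n≤m n (toℕ i)) n≤r) d e))

  binom-++-desc : ∀ u v d n →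
    binom (u ++ v) (desc d n) ≡ ∑[ i ≤ n ] (binom u (desc d (toℕ i)) * binom v (drop (toℕ i) (desc d n)))
  binom-++-desc u v d n = begin
    binom (u ++ v) (desc d n)                  ≡⟨ binom-++ u v (desc d n) ⟩
    ∑[ i ≤ length (desc d n) ] term (toℕ i)    ≡⟨ cong (λ N → ∑[ i ≤ N ] term (toℕ i)) (length-iterate prev d n) ⟩
    ∑[ i ≤ n ] term (toℕ i)                    ≡⟨ sum-cong-≗ {suc n} (λ i → cong (λ w → binom u w * binom v (drop (toℕ i) (desc d n)))
                                                                       (take-iterate prev d (toℕ≤pred[n] i))) ⟩
    ∑[ i ≤ n ] (binom u (desc d (toℕ i)) * binom v (drop (toℕ i) (desc d n))) ∎
    where
    open ≡-Reasoning
    term : ℕ → ℕ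
    term k = binom u (take k (desc d n)) * binom v (drop k (desc d n))

  binom-drop-desc : ∀ {r v} → Uniform r v → ∀ i d n → n ∸ i ≤ r →
                    binom v (drop i (desc d n)) ≡ binom v (desc d (n ∸ i))
  binom-drop-desc uv zero    d n       _       = refl
  binom-drop-desc uv (suc i) d zero    _       = refl
  binom-drop-desc uv (suc i) d (suc n) n∸i≤r = trans (binom-drop-desc uv i (prev d) n n∸i≤r) (uv n∸i≤r (prev d) d)

  binom-++-desc-conv : ∀ {r v} u → Uniform r v → ∀ {n} → n ≤ suc r → ∀ d → binom (u ++ v) (desc d n) ≡ conv u v n d
  binom-++-desc-conv {r} {v} u uv {n} n≤1+r d = trans (binom-++-desc u v d n) (sum-cong-≗ {suc n} (λ i →
    cong (binom u (desc d (toℕ i)) *_) (drop-desc i)))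
    where
    drop-desc : ∀ (i : Fin (suc n)) → binom v (drop (toℕ i) (desc d n)) ≡ binom v (desc d (n ∸ toℕ i))
    drop-desc zero    = refl
    drop-desc (suc i) =
      binom-drop-desc uv (suc (toℕ i)) d n (≤-trans (∸-monoˡ-≤ (suc (toℕ i)) n≤1+r) (m∸n≤m r (toℕ i)))

  uniform-++ : ∀ {r u v} → Uniform r u → Uniform r v → Uniform r (u ++ v)
  uniform-++ {u = u} {v} uu uv {n} n≤r d e = begin
    binom (u ++ v) (desc d n) ≡⟨ binom-++-desc-conv u uv (m≤n⇒m≤1+n n≤r) d ⟩
    conv u v n d              ≡⟨ conv-constant uu uv n≤r d e ⟩
    conv u v n e              ≡⟨ binom-++-desc-conv u uv (m≤n⇒m≤1+n n≤r) e ⟨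
    binom (u ++ v) (desc e n) ∎
    where open ≡-Reasoning

  binom-++-desc-comm : ∀ {r u v} → Uniform r u → Uniform r v → ∀ {n} → n ≤ suc r → ∀ d →
                       binom (u ++ v) (desc d n) ≡ binom (v ++ u) (desc d n)
  binom-++-desc-comm {u = u} {v} uu uv {n} n≤1+r d = begin
    binom (u ++ v) (desc d n) ≡⟨ binom-++-desc-conv u uv n≤1+r d ⟩
    conv u v n d              ≡⟨ conv-comm u v n d ⟩
    conv v u n d              ≡⟨ binom-++-desc-conv v uu n≤1+r d ⟨
    binom (v ++ u) (desc d n) ∎
    where open ≡-Reasoning

  binom-++-desc-top : ∀ {r v} u → Uniform r v → ∀ d →
    + binom (u ++ v) (desc d (2 + r))
      ≡ + conv u v (2 + r) d ℤ.+ + count u d ℤ.* (+ binom v (desc (prev d) (suc r)) - + binom v (desc d (suc r)))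
  -- Only the term taking one letter from u starts the descending word in v at prev d; by uniformity of v
  -- every other term of binom-++-desc agrees with the corresponding term of conv.
  binom-++-desc-top {r} {v} u uv d = pos-isolate-+-* {b = c} {c = conv u v (2 + r) d} {x = V} {y = V′} (begin
    binom (u ++ v) (desc d (2 + r)) + c * V  ≡⟨ cong (λ t → t + c * V) (binom-++-desc u v d (2 + r)) ⟩
    A + (c * V′ + R) + c * V                 ≡⟨ cong (λ t → A + (c * V′ + t) + c * V) R≡R′ ⟩
    A + (c * V′ + R′) + c * V                ≡⟨ swap A (c * V′) R′ (c * V) ⟩
    A + (c * V + R′) + c * V′                ∎)
    where
    open ≡-Reasoning
    A = 1 * binom v (desc d (2 + r))
    c = count u d
    V = binom v (desc d (suc r))
    V′ = binom v (desc (prev d) (suc r))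
    R R′ : ℕ
    R = ∑[ i ≤ r ] (binom u (desc d (2 + toℕ i)) * binom v (drop (2 + toℕ i) (desc d (2 + r))))
    R′ = ∑[ i ≤ r ] (binom u (desc d (2 + toℕ i)) * binom v (desc d (r ∸ toℕ i)))
    R≡R′ : R ≡ R′
    R≡R′ = sum-cong-≗ {suc r} (λ i → cong (binom u (desc d (2 + toℕ i)) *_)
                                            (binom-drop-desc uv (2 + toℕ i) d (2 + r) (m∸n≤m r (toℕ i))))
    swap : ∀ a x s y → a + (x + s) + y ≡ a + (y + s) + x
    swap = solve-∀

  conv-interior : List (Fin m) → List (Fin m) → ℕ → Fin m → ℕ
  conv-interior u v r d = ∑[ i < r ] (binom u (desc d (suc (toℕ i))) * binom v (desc d (r ∸ toℕ i)))

  conv-interior-constant : ∀ {r u v} → Uniform r u → Uniform r v → Constant (conv-interior u v r)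
  conv-interior-constant {r} uu uv d e = sum-cong-≗ {r} (λ i → cong₂ _*_ (uu (toℕ<n i) d e) (uv (m∸n≤m r (toℕ i)) d e))

  binom-++-desc-ends : ∀ {r v} u → Uniform r v → ∀ d →
    binom (u ++ v) (desc d (suc r)) ≡ binom u (desc d (suc r)) + binom v (desc d (suc r)) + conv-interior u v r d
  binom-++-desc-ends {r} {v} u uv d = begin
    binom (u ++ v) (desc d (suc r))           ≡⟨ binom-++-desc-conv u uv ≤-refl d ⟩
    ∑[ i ≤ suc r ] term (toℕ i)               ≡⟨ ∑-ends r term ⟩
    1 * V + I + U * binom v (desc d (r ∸ r))  ≡⟨ cong (λ k → 1 * V + I + U * binom v (desc d k)) (n∸n≡0 r) ⟩
    1 * V + I + U * 1                         ≡⟨ arith U V I ⟩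
    U + V + I                                 ∎
    where
    open ≡-Reasoning
    I = conv-interior u v r d
    U = binom u (desc d (suc r))
    V = binom v (desc d (suc r))
    term : ℕ → ℕ
    term k = binom u (desc d k) * binom v (desc d (suc r ∸ k))
    arith : ∀ U V M → 1 * V + M + U * 1 ≡ U + V + M
    arith = solve-∀

  uniform-[] : ∀ {r} → Uniform r []
  uniform-[] {n = zero}  _ d e = refl
  uniform-[] {n = suc n} _ d e = refl

  σw^-[] : ∀ r → σw^ m r [] ≡ []
  σw^-[] zero    = refl
  σw^-[] (suc r) = cong (σw m) (σw^-[] r)

  uniform-σw^ : ∀ {r} → (∀ x → Uniform r (σw^ m r [ x ])) → ∀ w → Uniform r (σw^ m r w)
  uniform-σw^ {r} uσ []      = subst (Uniform r) (sym (σw^-[] r)) uniform-[]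
  uniform-σw^ {r} uσ (x ∷ w) = subst (Uniform r) (sym (σw^-++ r [ x ] w)) (uniform-++ (uσ x) (uniform-σw^ uσ w))

  uniform-step : ∀ {r} → (∀ x → Uniform r (σw^ m r [ x ])) → ∀ x → Uniform (suc r) (σw^ m (suc r) [ x ])
  uniform-step {r} uσ x {n} n≤1+r = prev-invariant⇒constant φ φ-prev
    where
    W = σw^ m r [ x ]
    U = σw^ m r (rest x)
    φ : Fin m → ℕ
    φ d = binom (σw^ m (suc r) [ x ]) (desc d n)
    φ-prev : ∀ d → φ (prev d) ≡ φ d
    φ-prev d = begin
      binom (σw^ m (suc r) [ x ]) (desc (prev d) n)       ≡⟨ binom-σw^-prev (suc r) x d n ⟩
      binom (σw^ m (suc r) [ shift 1 x ]) (desc d n)      ≡⟨ cong (λ u → binom u (desc d n)) (σw^-suc-split-shift r x) ⟩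
      binom (U ++ W) (desc d n)                           ≡⟨ binom-++-desc-comm (uniform-σw^ uσ (rest x)) (uσ x) n≤1+r d ⟩
      binom (W ++ U) (desc d n)                           ≡⟨ cong (λ u → binom u (desc d n)) (σw^-suc-split r x) ⟨
      binom (σw^ m (suc r) [ x ]) (desc d n)              ∎
      where open ≡-Reasoning

  AffineInCount : ℕ → List (Fin m) → Set
  AffineInCount r w = ∀ d e →
    + binom (σw^ m r w) (desc e (suc r)) - + binom (σw^ m r w) (desc d (suc r))
      ≡ + (m ^ (r C 2)) ℤ.* (+ count w e - + count w d)

  affine-zero : ∀ w → AffineInCount 0 w
  affine-zero w d e = sym (ℤₚ.*-identityˡ (+ count w e - + count w d))

  affine-[] : ∀ r → AffineInCount r []
  affine-[] r d e rewrite σw^-[] r = sym (ℤₚ.*-zeroʳ (+ (m ^ (r C 2))))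

  affine-++ : ∀ {r u v} → Uniform r (σw^ m r u) → Uniform r (σw^ m r v) →
              AffineInCount r u → AffineInCount r v → AffineInCount r (u ++ v)
  affine-++ {r} {u} {v} uu uv au av d e = begin
    + φ (u ++ v) e - + φ (u ++ v) d
      ≡⟨ cong₂ (λ p q → + p - + q) (split e) (split d) ⟩
    + (φ u e + φ v e + conv-interior u′ v′ r e) - + (φ u d + φ v d + conv-interior u′ v′ r d)
      ≡⟨ cong (λ t → + (φ u e + φ v e + conv-interior u′ v′ r e) - + (φ u d + φ v d + t)) (conv-interior-constant uu uv d e) ⟩
    + (φ u e + φ v e + conv-interior u′ v′ r e) - + (φ u d + φ v d + conv-interior u′ v′ r e)
      ≡⟨ pos-difference-+ (φ u e) (φ v e) (conv-interior u′ v′ r e) (φ u d) (φ v d) ⟩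
    (+ φ u e - + φ u d) ℤ.+ (+ φ v e - + φ v d)
      ≡⟨ cong₂ ℤ._+_ (au d e) (av d e) ⟩
    M ℤ.* (+ count u e - + count u d) ℤ.+ M ℤ.* (+ count v e - + count v d)
      ≡⟨ collect M (+ count u e) (+ count u d) (+ count v e) (+ count v d) ⟩
    M ℤ.* ((+ count u e ℤ.+ + count v e) - (+ count u d ℤ.+ + count v d))
      ≡⟨ cong₂ (λ p q → M ℤ.* (p - q)) (pos-count-++ e) (pos-count-++ d) ⟨
    M ℤ.* (+ count (u ++ v) e - + count (u ++ v) d) ∎
    where
    open ≡-Reasoning
    u′ = σw^ m r u
    v′ = σw^ m r v
    M = + (m ^ (r C 2))
    φ : List (Fin m) → Fin m → ℕ
    φ w x = binom (σw^ m r w) (desc x (suc r))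
    split : ∀ x → φ (u ++ v) x ≡ φ u x + φ v x + conv-interior u′ v′ r x
    split x = trans (cong (λ w → binom w (desc x (suc r))) (σw^-++ r u v)) (binom-++-desc-ends u′ uv x)
    pos-count-++ : ∀ x → + count (u ++ v) x ≡ + count u x ℤ.+ + count v x
    pos-count-++ x = trans (cong +_ (count-++ u v x)) (ℤₚ.pos-+ (count u x) (count v x))
    collect : ∀ M a b c d → M ℤ.* (a - b) ℤ.+ M ℤ.* (c - d) ≡ M ℤ.* ((a ℤ.+ c) - (b ℤ.+ d))
    collect = ℤ-Ring.solve-∀

  affine-σw^ : ∀ {r} → (∀ x → Uniform r (σw^ m r [ x ])) → (∀ x → AffineInCount r [ x ]) → ∀ w → AffineInCount r w
  affine-σw^ {r} uσ aσ []      = affine-[] r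
  affine-σw^ {r} uσ aσ (x ∷ w) = affine-++ (uσ x) (uniform-σw^ uσ w) (aσ x) (affine-σw^ uσ aσ w)

  affine-step : ∀ {r} → (∀ x → Uniform r (σw^ m r [ x ])) → (∀ x → AffineInCount r [ x ]) →
                ∀ x → AffineInCount (suc r) [ x ]
  affine-step {r} uσ aσ x = differences-from-prev G δ (+ (m ^ (suc r C 2))) increment
    where
    open ≡-Reasoning
    W = σw^ m r [ x ]
    U = σw^ m r (rest x)
    M = + (m ^ (r C 2))
    G δ : Fin m → ℤ
    G d = + binom (σw^ m (suc r) [ x ]) (desc d (2 + r))
    δ d = + count [ x ] d
    Δ : List (Fin m) → Fin m → ℤ
    Δ w d = + binom w (desc (prev d) (suc r)) - + binom w (desc d (suc r))

    G≡ : ∀ d → G d ≡ + conv W U (2 + r) d ℤ.+ + count W d ℤ.* Δ U d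
    G≡ d = trans (cong (λ w → + binom w (desc d (2 + r))) (σw^-suc-split r x))
                 (binom-++-desc-top W (uniform-σw^ uσ (rest x)) d)

    G-prev≡ : ∀ d → G (prev d) ≡ + conv W U (2 + r) d ℤ.+ + count U d ℤ.* Δ W d
    G-prev≡ d = begin
      G (prev d)                                     ≡⟨ cong +_ (binom-σw^-prev (suc r) x d (2 + r)) ⟩
      + binom (σw^ m (suc r) [ shift 1 x ]) (desc d (2 + r))
                                                     ≡⟨ cong (λ w → + binom w (desc d (2 + r))) (σw^-suc-split-shift r x) ⟩
      + binom (U ++ W) (desc d (2 + r))              ≡⟨ binom-++-desc-top U (uσ x) d ⟩
      + conv U W (2 + r) d ℤ.+ + count U d ℤ.* Δ W d ≡⟨ cong (λ c → + c ℤ.+ + count U d ℤ.* Δ W d) (conv-comm U W (2 + r) d) ⟩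
      + conv W U (2 + r) d ℤ.+ + count U d ℤ.* Δ W d ∎

    count-rest : ∀ d → + count (rest x) d ≡ + 1 - δ d
    count-rest d = pos-isolate-+ (begin
      count [ x ] d + count (rest x) d ≡⟨ count-++ [ x ] (rest x) d ⟨
      count (x ∷ rest x) d             ≡⟨ cong (λ w → count w d) (σ-∷ x) ⟨
      count (σ m x) d                  ≡⟨ count-σ x d ⟩
      1                                ∎)

    ΔU≡ : ∀ d → Δ U d ≡ M ℤ.* (δ d - δ (prev d))
    ΔU≡ d = begin
      Δ U d                                                       ≡⟨ affine-σw^ uσ aσ (rest x) d (prev d) ⟩
      M ℤ.* (+ count (rest x) (prev d) - + count (rest x) d)      ≡⟨ cong₂ (λ p q → M ℤ.* (p - q)) (count-rest (prev d)) (count-rest d) ⟩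
      M ℤ.* ((+ 1 - δ (prev d)) - (+ 1 - δ d))                    ≡⟨ complement M (δ d) (δ (prev d)) ⟩
      M ℤ.* (δ d - δ (prev d))                                    ∎
      where
      complement : ∀ M δ δ′ → M ℤ.* ((+ 1 - δ′) - (+ 1 - δ)) ≡ M ℤ.* (δ - δ′)
      complement = ℤ-Ring.solve-∀

    count-W+U : ∀ d → + count W d ℤ.+ + count U d ≡ + (m ^ r)
    count-W+U d = trans (sym (ℤₚ.pos-+ (count W d) (count U d))) (cong +_ (begin
      count W d + count U d            ≡⟨ count-++ W U d ⟨
      count (W ++ U) d                 ≡⟨ cong (λ w → count w d) (σw^-suc-split r x) ⟨
      count (σw^ m (suc r) [ x ]) d    ≡⟨ count-σw^-suc r x d ⟩
      m ^ r                            ∎))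

    slope : + (m ^ r) ℤ.* M ≡ + (m ^ (suc r C 2))
    slope = trans (sym (ℤₚ.pos-* (m ^ r) (m ^ (r C 2)))) (cong +_ (sym (^-C2-suc m r)))

    increment : ∀ d → G d - G (prev d) ≡ + (m ^ (suc r C 2)) ℤ.* (δ d - δ (prev d))
    increment d = begin
      G d - G (prev d)
        ≡⟨ cong₂ _-_ (G≡ d) (G-prev≡ d) ⟩
      (S ℤ.+ a ℤ.* Δ U d) - (S ℤ.+ b ℤ.* Δ W d)
        ≡⟨ cong₂ (λ p q → (S ℤ.+ a ℤ.* p) - (S ℤ.+ b ℤ.* q)) (ΔU≡ d) (aσ x d (prev d)) ⟩
      (S ℤ.+ a ℤ.* (M ℤ.* (δ d - δ (prev d)))) - (S ℤ.+ b ℤ.* (M ℤ.* (δ (prev d) - δ d)))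
        ≡⟨ regroup S a b M (δ d) (δ (prev d)) ⟩
      (a ℤ.+ b) ℤ.* M ℤ.* (δ d - δ (prev d))
        ≡⟨ cong (λ t → t ℤ.* (δ d - δ (prev d))) (trans (cong (ℤ._* M) (count-W+U d)) slope) ⟩
      + (m ^ (suc r C 2)) ℤ.* (δ d - δ (prev d))
        ∎
      where
      S = + conv W U (2 + r) d
      a = + count W d
      b = + count U d
      regroup : ∀ S a b M δ δ′ → (S ℤ.+ a ℤ.* (M ℤ.* (δ - δ′))) - (S ℤ.+ b ℤ.* (M ℤ.* (δ′ - δ))) ≡ (a ℤ.+ b) ℤ.* M ℤ.* (δ - δ′)
      regroup = ℤ-Ring.solve-∀

  uniform : ∀ r x → Uniform r (σw^ m r [ x ])
  uniform zero    x = uniform-zero [ x ]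
  uniform (suc r) x = uniform-step (uniform r) x

  affine : ∀ r x → AffineInCount r [ x ]
  affine zero    x = affine-zero [ x ]
  affine (suc r) x = affine-step (uniform r) (affine r) x

  binom-σw^-diagonal : ∀ r x n → binom (σw^ m r [ letter m 0 ]) (desc (letter m 0) n) ≡ binom (σw^ m r [ x ]) (desc x n)
  binom-σw^-diagonal r x n = trans (sym (binom-σw^-shift (toℕ x) r [ letter m 0 ] (letter m 0) n))
                               (cong (λ y → binom (σw^ m r [ y ]) (desc y n)) (letter-toℕ x))

proposition4p1 : (m k : ℕ) .{{_ : NonZero m}} → 2 ≤ m → 1 ≤ k → (j : Fin m) → j ≢ letter m 0 →
    (+ binom (σw^ m k [ letter m 0 ]) (negWord m k)) - (+ binom (σw^ m k [ j ]) (negWord m k)) ≡ + (m ^ (k C 2))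
proposition4p1 m@(suc _) k _ _ j j≢0 = begin
  + binom (σw^ m k [ 0̂ ]) (negWord m k) - + binom (σw^ m k [ j ]) (negWord m k)
    ≡⟨ cong (λ w → + binom (σw^ m k [ 0̂ ]) w - + binom (σw^ m k [ j ]) w) (negWord-desc k) ⟩
  + binom (σw^ m k [ 0̂ ]) (desc 0̂ (suc k)) - + binom (σw^ m k [ j ]) (desc 0̂ (suc k))
    ≡⟨ cong (λ t → + t - + binom (σw^ m k [ j ]) (desc 0̂ (suc k))) (binom-σw^-diagonal k j (suc k)) ⟩
  + binom (σw^ m k [ j ]) (desc j (suc k)) - + binom (σw^ m k [ j ]) (desc 0̂ (suc k))
    ≡⟨ affine k j 0̂ j ⟩
  + (m ^ (k C 2)) ℤ.* (+ count [ j ] j - + count [ j ] 0̂)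
    ≡⟨ cong₂ (λ p q → + (m ^ (k C 2)) ℤ.* (+ p - + q)) (count-self j) (count-other j≢0) ⟩
  + (m ^ (k C 2)) ℤ.* + 1
    ≡⟨ ℤₚ.*-identityʳ (+ (m ^ (k C 2))) ⟩
  + (m ^ (k C 2))
    ∎
  where
  open ≡-Reasoning
  0̂ = letter m 0
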